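{- Let $n,d,k,\ell \in \mathbb{N}$ with $\ell \le n/2$ and $d \le 2^{ -5} n$. If $$\frac{2k\ell}{n} > d + \frac{2^5 d^2}{n} + 4\sqrt{d} \log n,$$ then there exists a graph $G$ with $n$ vertices and $\delta(G) \ge d$, together with a proper edge-colouring of $G$ using at most $k$ colours in which each colour is used on at most $\ell$ edges.
   Context: An edge-colouring is proper if any two edges sharing an endpoint receive different colours. $\delta(G)$ is the minimum degree of $G$. -}

module Defs where

open import Data.Nat as ℕ using (ℕ; zero; suc; _≡ᵇ_; _<ᵇ_)
open import Data.Fin using (Fin; toℕ)
open import Data.Bool using (Bool; true; false; _∧_)
open import Data.List using (List; length; filterᵇ; allFin; map)
open import Data.Nat.ListAction using (sum)
open import Data.Integer using (+_)
open import Data.Rational using (ℚ; 0ℚ; 1ℚ; _+_; _*_; _/_)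
open import Relation.Binary.PropositionalEquality using (_≡_; _≢_)

record Graph (n : ℕ) : Set where
  field
    adj     : Fin n → Fin n → Bool
    symm    : ∀ u v → adj u v ≡ adj v u
    irrefl  : ∀ u → adj u u ≡ false

open Graph public

deg : ∀ {n} → Graph n → Fin n → ℕ
deg {n} G u = length (filterᵇ (adj G u) (allFin n))

MinDegreeAtLeast : ∀ {n} → Graph n → ℕ → Set
MinDegreeAtLeast G d = ∀ u → d ℕ.≤ deg G u

-- Edge-colourings with colours from Fin k.
-- The colour of the edge uv is col u v (= col v u); values on non-edges
-- are irrelevant.

record EdgeColouring {n : ℕ} (G : Graph n) (k : ℕ) : Set where
  field
    col      : Fin n → Fin n → Fin k
    col-symm : ∀ u v → adj G u v ≡ true → col u v ≡ col v u

open EdgeColouring public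

Proper : ∀ {n k} {G : Graph n} → EdgeColouring G k → Set
Proper {n} {k} {G} c =
  ∀ u v w → adj G u v ≡ true → adj G u w ≡ true → v ≢ w → col c u v ≢ col c u w

colourClassSize : ∀ {n k} {G : Graph n} → EdgeColouring G k → Fin k → ℕ
colourClassSize {n} {k} {G} c i =
  sum (map (λ u → length (filterᵇ
              (λ v → adj G u v ∧ (toℕ u <ᵇ toℕ v) ∧ (toℕ (col c u v) ≡ᵇ toℕ i))
              (allFin n)))
           (allFin n))

-- Real-number inequality  X > 4 √d · ln n  (X rational, d,n naturals, n ≥ 1)
-- encoded exactly with rationals:
--   X > 0  and  ∃ q ∈ ℚ, N ∈ ℕ :  16·d·q² < X²  and  Σ_{j<N} q^j/j! > n.

expTerm : ℚ → ℕ → ℚ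
expTerm q zero    = 1ℚ
expTerm q (suc j) = expTerm q j * (q * ((+ 1) / suc j))

expPartial : ℚ → ℕ → ℚ
expPartial q zero    = 0ℚ
expPartial q (suc N) = expPartial q N + expTerm q N

fromℕ : ℕ → ℚ
fromℕ m = (+ m) / 1

{-# OPTIONS --safe #-}
module Submission where

-- Split the n vertices into a side A of size ⌈n/2⌉ and a side B = ℤ/m, m = ⌊n/2⌋, and join
-- x ∈ A to (x + r) mod m for every shift r < d; every vertex then has at least d neighbours.
-- Number the edge at x with shift r by r(m+1) + x and give it colour ⌊(r(m+1) + x)/ℓ⌋: each
-- colour class is a block of ℓ consecutive numbers, and as all numbers are below
-- d(m+1) ≤ kℓ, k colours suffice. Since m + 1 ≡ 1 (mod m), the numbers of the edges at x
-- are ≡ x (mod m+1) and those of the edges at y ∈ B are ≡ y (mod m); two numbers in one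
-- block of length ℓ ≤ m that are congruent modulo m or m+1 are equal, so the colouring is
-- proper. The bound d(m+1) ≤ kℓ already follows from 2kℓ/n − d − 32d²/n > 0.

open import Defs
open import Data.Bool using (Bool; true; false; T; _∧_)
open import Data.Bool.Properties using (T?; T-≡)
open import Data.Empty using (⊥; ⊥-elim)
open import Data.Fin as Fin using (Fin; toℕ; fromℕ<; splitAt; join; _↑ˡ_; _↑ʳ_)
open import Data.Fin.Properties
  using (injective⇒≤; toℕ-fromℕ<; toℕ-injective; toℕ<n; splitAt-join; join-splitAt;
         ↑ˡ-injective; ↑ʳ-injective; toℕ-↑ˡ; toℕ-↑ʳ)
open import Data.Integer as ℤ using (ℤ; +_)
import Data.Integer.Properties as ℤ
import Data.Integer.Tactic.RingSolver as ℤ-Solver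
open import Data.List using (List; []; _∷_; length; lookup; map; filterᵇ; allFin; cartesianProduct; _++_)
open import Data.List.Membership.Propositional using (_∈_)
open import Data.List.Membership.Propositional.Properties using (∈-lookup; ∈-filter⁺; ∈-filter⁻; ∈-allFin)
import Data.List.Membership.Setoid.Properties as SetoidMembership
open import Data.List.Properties using (length-++; filter-++)
open import Data.List.Relation.Unary.AllPairs using (_∷_)
open import Data.List.Relation.Unary.Unique.Propositional using (Unique)
open import Data.List.Relation.Unary.Unique.Propositional.Properties
  using (Unique[x∷xs]⇒x∉xs; filter⁺; cartesianProduct⁺; allFin⁺)
open import Data.Nat
  using (ℕ; zero; suc; _+_; _*_; _∸_; _^_; _%_; _/_; _≤_; _<_; _<ᵇ_; _≡ᵇ_; ⌊_/2⌋; ⌈_/2⌉;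
         NonZero; >-nonZero; z≤n)
open import Data.Nat.DivMod
  using (_mod_; %-distribˡ-+; m%n%n≡m%n; m≡m%n+[m/n]*n; [m+kn]%n≡m%n; m%n≤n; m%n<n; m<n⇒m%n≡m;
         m/n≡1+[m∸n]/n; /-monoˡ-≤; m<n*o⇒m/o<n)
open import Data.Nat.ListAction using (sum)
open import Data.Nat.Properties
open import Algebra.Properties.CommutativeSemigroup +-commutativeSemigroup using (x∙yz≈y∙xz; xy∙z≈y∙xz)
open import Data.Nat.Tactic.RingSolver using (solve-∀)
open import Data.Product using (Σ; ∃; ∃₂; _×_; _,_; proj₁; proj₂; uncurry)
open import Data.Rational as ℚ using (ℚ; 0ℚ; toℚᵘ) renaming (_<_ to _<ℚ_; _-_ to _-ℚ_; _*_ to _*ℚ_; _/_ to _/ℚ_)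
import Data.Rational.Properties as ℚ
open import Data.Rational.Unnormalised as ℚᵘ using (ℚᵘ; mkℚᵘ; _≃_; *<*; ↥_)
import Data.Rational.Unnormalised.Properties as ℚᵘ
open import Data.Sum using (_⊎_; inj₁; inj₂)
open import Function using (_∘_; Equivalence)
open import Function.Definitions using (Injective)
open import Relation.Binary.Definitions using (tri<; tri≈; tri>)
open import Relation.Binary.PropositionalEquality

T-∧₃ : ∀ x y {z} → T (x ∧ y ∧ z) → T x × T y × T z
T-∧₃ true true t = _ , _ , t

length-filterᵇ-map : {A B : Set} (p : B → Bool) (f : A → B) (xs : List A) →
                     length (filterᵇ p (map f xs)) ≡ length (filterᵇ (p ∘ f) xs)
length-filterᵇ-map p f []       = refl
length-filterᵇ-map p f (x ∷ xs) with p (f x)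
... | true  = cong suc (length-filterᵇ-map p f xs)
... | false = length-filterᵇ-map p f xs

sum-length-filterᵇ : {A B : Set} (p : A → B → Bool) (xs : List A) (ys : List B) →
                     sum (map (λ x → length (filterᵇ (p x) ys)) xs) ≡
                     length (filterᵇ (uncurry p) (cartesianProduct xs ys))
sum-length-filterᵇ p []       ys = refl
sum-length-filterᵇ p (x ∷ xs) ys = begin
  length (filterᵇ (p x) ys) + sum (map (λ x → length (filterᵇ (p x) ys)) xs)
    ≡⟨ cong₂ _+_ (sym (length-filterᵇ-map (uncurry p) (x ,_) ys)) (sum-length-filterᵇ p xs ys) ⟩
  length (filterᵇ (uncurry p) (map (x ,_) ys)) + length (filterᵇ (uncurry p) (cartesianProduct xs ys))
    ≡⟨ length-++ (filterᵇ (uncurry p) (map (x ,_) ys)) ⟨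
  length (filterᵇ (uncurry p) (map (x ,_) ys) ++ filterᵇ (uncurry p) (cartesianProduct xs ys))
    ≡⟨ cong length (filter-++ (T? ∘ uncurry p) (map (x ,_) ys) (cartesianProduct xs ys)) ⟨
  length (filterᵇ (uncurry p) (cartesianProduct (x ∷ xs) ys))
    ∎
  where open ≡-Reasoning

module _ {A : Set} where

  Unique⇒lookup-injective : ∀ {xs : List A} → Unique xs → ∀ {i j} → lookup xs i ≡ lookup xs j → i ≡ j
  Unique⇒lookup-injective {_ ∷ _}  _       {Fin.zero}  {Fin.zero}  _  = refl
  Unique⇒lookup-injective {_ ∷ xs} u       {Fin.zero}  {Fin.suc j} eq =
    ⊥-elim (Unique[x∷xs]⇒x∉xs u (subst (_∈ xs) (sym eq) (∈-lookup j)))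
  Unique⇒lookup-injective {_ ∷ xs} u       {Fin.suc i} {Fin.zero}  eq =
    ⊥-elim (Unique[x∷xs]⇒x∉xs u (subst (_∈ xs) eq (∈-lookup i)))
  Unique⇒lookup-injective {_ ∷ _}  (_ ∷ u) {Fin.suc i} {Fin.suc j} eq =
    cong Fin.suc (Unique⇒lookup-injective u eq)

  injective⇒≤length : ∀ {d} {xs : List A} (f : Fin d → A) → Injective _≡_ _≡_ f →
                      (∀ j → f j ∈ xs) → d ≤ length xs
  injective⇒≤length f f-inj f∈xs = injective⇒≤ λ eq →
    f-inj (SetoidMembership.index-injective (setoid A) (f∈xs _) (f∈xs _) eq)

  Unique⇒length≤ : ∀ {L} {xs : List A} → Unique xs → (h : A → ℕ) → (∀ {u} → u ∈ xs → h u < L) →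
                   (∀ {u v} → u ∈ xs → v ∈ xs → h u ≡ h v → u ≡ v) → length xs ≤ L
  Unique⇒length≤ u h h<L h-inj = injective⇒≤ {f = λ i → fromℕ< (h<L (∈-lookup i))} λ {i} {j} eq →
    Unique⇒lookup-injective u (h-inj (∈-lookup i) (∈-lookup j)
      (trans (sym (toℕ-fromℕ< (h<L (∈-lookup i)))) (trans (cong toℕ eq) (toℕ-fromℕ< (h<L (∈-lookup j))))))

AtLeast : {A : Set} → ℕ → (A → Set) → Set
AtLeast {A} d P = Σ (Fin d → A) λ f → Injective _≡_ _≡_ f × ∀ j → P (f j)

atLeast⇒≤deg : ∀ {n d} (G : Graph n) {u} → AtLeast d (λ v → T (adj G u v)) → d ≤ deg G u
atLeast⇒≤deg G {u} (f , f-inj , f-adj) =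
  injective⇒≤length f f-inj λ j → ∈-filter⁺ (T? ∘ adj G u) (∈-allFin (f j)) (f-adj j)

[m%o+n]%o≡[m+n]%o : ∀ m n o .{{_ : NonZero o}} → (m % o + n) % o ≡ (m + n) % o
[m%o+n]%o≡[m+n]%o m n o = begin
  (m % o + n) % o          ≡⟨ %-distribˡ-+ (m % o) n o ⟩
  (m % o % o + n % o) % o  ≡⟨ cong (λ i → (i + n % o) % o) (m%n%n≡m%n m o) ⟩
  (m % o + n % o) % o      ≡⟨ %-distribˡ-+ m n o ⟨
  (m + n) % o              ∎
  where open ≡-Reasoning

[m+n%o]%o≡[m+n]%o : ∀ m n o .{{_ : NonZero o}} → (m + n % o) % o ≡ (m + n) % o
[m+n%o]%o≡[m+n]%o m n o = begin
  (m + n % o) % o  ≡⟨ cong (_% o) (+-comm m (n % o)) ⟩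
  (n % o + m) % o  ≡⟨ [m%o+n]%o≡[m+n]%o n m o ⟩
  (n + m) % o      ≡⟨ cong (_% o) (+-comm n m) ⟩
  (m + n) % o      ∎
  where open ≡-Reasoning

module Modular (m : ℕ) .{{_ : NonZero m}} where

  infixl 7 _⊖_

  _⊖_ : ℕ → ℕ → ℕ
  y ⊖ x = (y + (m ∸ x % m)) % m

  ⊖<m : ∀ y x → y ⊖ x < m
  ⊖<m y x = m%n<n (y + (m ∸ x % m)) m

  private
    x+[m∸x%m]≡[1+x/m]*m : ∀ x → x + (m ∸ x % m) ≡ suc (x / m) * m
    x+[m∸x%m]≡[1+x/m]*m x = begin
      x + (m ∸ x % m)                    ≡⟨ cong (_+ (m ∸ x % m)) (m≡m%n+[m/n]*n x m) ⟩
      x % m + x / m * m + (m ∸ x % m)    ≡⟨ cong (_+ (m ∸ x % m)) (+-comm (x % m) (x / m * m)) ⟩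
      x / m * m + x % m + (m ∸ x % m)    ≡⟨ +-assoc (x / m * m) (x % m) (m ∸ x % m) ⟩
      x / m * m + (x % m + (m ∸ x % m))  ≡⟨ cong (_+_ (x / m * m)) (m+[n∸m]≡n (m%n≤n x m)) ⟩
      x / m * m + m                      ≡⟨ +-comm (x / m * m) m ⟩
      suc (x / m) * m                    ∎
      where open ≡-Reasoning

    [z+[x+[m∸x%m]]]%m≡z%m : ∀ z x → (z + (x + (m ∸ x % m))) % m ≡ z % m
    [z+[x+[m∸x%m]]]%m≡z%m z x =
      trans (cong (λ i → (z + i) % m) (x+[m∸x%m]≡[1+x/m]*m x)) ([m+kn]%n≡m%n z (suc (x / m)) m)

  [x+[y⊖x]]%m≡y%m : ∀ x y → (x + (y ⊖ x)) % m ≡ y % m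
  [x+[y⊖x]]%m≡y%m x y = begin
    (x + (y + (m ∸ x % m)) % m) % m  ≡⟨ [m+n%o]%o≡[m+n]%o x (y + (m ∸ x % m)) m ⟩
    (x + (y + (m ∸ x % m))) % m      ≡⟨ cong (_% m) (x∙yz≈y∙xz x y (m ∸ x % m)) ⟩
    (y + (x + (m ∸ x % m))) % m      ≡⟨ [z+[x+[m∸x%m]]]%m≡z%m y x ⟩
    y % m                            ∎
    where open ≡-Reasoning

  [x+r]%m⊖x≡r%m : ∀ x r → ((x + r) % m) ⊖ x ≡ r % m
  [x+r]%m⊖x≡r%m x r = begin
    ((x + r) % m + (m ∸ x % m)) % m  ≡⟨ [m%o+n]%o≡[m+n]%o (x + r) (m ∸ x % m) m ⟩
    (x + r + (m ∸ x % m)) % m        ≡⟨ cong (_% m) (xy∙z≈y∙xz x r (m ∸ x % m)) ⟩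
    (r + (x + (m ∸ x % m))) % m      ≡⟨ [z+[x+[m∸x%m]]]%m≡z%m r x ⟩
    r % m                            ∎
    where open ≡-Reasoning

  ⊖-congˡ : ∀ {y y'} x → y % m ≡ y' % m → y ⊖ x ≡ y' ⊖ x
  ⊖-congˡ {y} {y'} x eq = begin
    (y + (m ∸ x % m)) % m       ≡⟨ [m%o+n]%o≡[m+n]%o y (m ∸ x % m) m ⟨
    (y % m + (m ∸ x % m)) % m   ≡⟨ cong (λ i → (i + (m ∸ x % m)) % m) eq ⟩
    (y' % m + (m ∸ x % m)) % m  ≡⟨ [m%o+n]%o≡[m+n]%o y' (m ∸ x % m) m ⟩
    (y' + (m ∸ x % m)) % m      ∎
    where open ≡-Reasoning

  y⊖[y⊖r]≡r%m : ∀ y r → y ⊖ (y ⊖ r) ≡ r % m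
  y⊖[y⊖r]≡r%m y r = begin
    y ⊖ (y ⊖ r)                    ≡⟨ ⊖-congˡ (y ⊖ r) (sym (trans (m%n%n≡m%n (y ⊖ r + r) m) [y⊖r+r]%m≡y%m)) ⟩
    ((y ⊖ r + r) % m) ⊖ (y ⊖ r)    ≡⟨ [x+r]%m⊖x≡r%m (y ⊖ r) r ⟩
    r % m                          ∎
    where
    open ≡-Reasoning
    [y⊖r+r]%m≡y%m : ((y ⊖ r) + r) % m ≡ y % m
    [y⊖r+r]%m≡y%m = trans (cong (_% m) (+-comm (y ⊖ r) r)) ([x+[y⊖x]]%m≡y%m r y)

%-≡⇒+-≤ : ∀ {a b} p .{{_ : NonZero p}} → a % p ≡ b % p → a < b → a + p ≤ b
%-≡⇒+-≤ {a} {b} p eq a<b = begin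
  a + p                    ≡⟨ cong (_+ p) (m≡m%n+[m/n]*n a p) ⟩
  a % p + a / p * p + p    ≡⟨ +-assoc (a % p) (a / p * p) p ⟩
  a % p + (a / p * p + p)  ≡⟨ cong (_+_ (a % p)) (+-comm (a / p * p) p) ⟩
  a % p + suc (a / p) * p  ≤⟨ +-mono-≤ (≤-reflexive eq) (*-monoˡ-≤ p a/p<b/p) ⟩
  b % p + b / p * p        ≡⟨ m≡m%n+[m/n]*n b p ⟨
  b                        ∎
  where
  open ≤-Reasoning
  a/p<b/p : a / p < b / p
  a/p<b/p = ≰⇒> λ b/p≤a/p → <⇒≱ a<b (begin
    b                  ≡⟨ m≡m%n+[m/n]*n b p ⟩
    b % p + b / p * p  ≤⟨ +-mono-≤ (≤-reflexive (sym eq)) (*-monoˡ-≤ p b/p≤a/p) ⟩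
    a % p + a / p * p  ≡⟨ m≡m%n+[m/n]*n a p ⟨
    a                  ∎)

+-≤⇒/-< : ∀ {a b} o .{{_ : NonZero o}} → a + o ≤ b → a / o < b / o
+-≤⇒/-< {a} {b} o a+o≤b = begin-strict
  a / o                  <⟨ n<1+n (a / o) ⟩
  suc (a / o)            ≡⟨ cong (λ i → suc (i / o)) (m+n∸n≡m a o) ⟨
  suc ((a + o ∸ o) / o)  ≡⟨ m/n≡1+[m∸n]/n (m≤n+m o a) ⟨
  (a + o) / o            ≤⟨ /-monoˡ-≤ o a+o≤b ⟩
  b / o                  ∎
  where open ≤-Reasoning

/-%-injective : ∀ {a b o p} .{{_ : NonZero o}} .{{_ : NonZero p}} →
                o ≤ p → a / o ≡ b / o → a % p ≡ b % p → a ≡ b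
/-%-injective {o = o} {p} o≤p = sameBlock
  where
  separated : ∀ {a b} → a / o ≡ b / o → a % p ≡ b % p → a < b → ⊥
  separated {a} /-eq %-eq a<b =
    <-irrefl /-eq (+-≤⇒/-< o (≤-trans (+-monoʳ-≤ a o≤p) (%-≡⇒+-≤ p %-eq a<b)))

  sameBlock : ∀ {a b} → a / o ≡ b / o → a % p ≡ b % p → a ≡ b
  sameBlock {a} {b} /-eq %-eq with <-cmp a b
  ... | tri< a<b _ _ = ⊥-elim (separated /-eq %-eq a<b)
  ... | tri≈ _ a≡b _ = a≡b
  ... | tri> _ _ b<a = ⊥-elim (separated (sym /-eq) (sym %-eq) b<a)

module Bipartite {a b : ℕ} where

  acrossSides : {X : Set} → X → (Fin a → Fin b → X) → Fin a ⊎ Fin b → Fin a ⊎ Fin b → X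
  acrossSides z f (inj₁ x) (inj₂ y) = f x y
  acrossSides z f (inj₂ y) (inj₁ x) = f x y
  acrossSides z f _        _        = z

  across : {X : Set} → X → (Fin a → Fin b → X) → Fin (a + b) → Fin (a + b) → X
  across z f u v = acrossSides z f (splitAt a u) (splitAt a v)

  module _ {X : Set} (z : X) (f : Fin a → Fin b → X) where

    acrossSides-sym : ∀ s t → acrossSides z f s t ≡ acrossSides z f t s
    acrossSides-sym (inj₁ _) (inj₁ _) = refl
    acrossSides-sym (inj₁ _) (inj₂ _) = refl
    acrossSides-sym (inj₂ _) (inj₁ _) = refl
    acrossSides-sym (inj₂ _) (inj₂ _) = refl

    acrossSides-diag : ∀ s → acrossSides z f s s ≡ z
    acrossSides-diag (inj₁ _) = refl
    acrossSides-diag (inj₂ _) = refl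

    across-join : ∀ s t → across z f (join a b s) (join a b t) ≡ acrossSides z f s t
    across-join s t rewrite splitAt-join a b s | splitAt-join a b t = refl

  data Side : Fin (a + b) → Set where
    side : ∀ s → Side (join a b s)

  view : ∀ u → Side u
  view u = subst Side (join-splitAt a b u) (side (splitAt a u))

  module _ (E : Fin a → Fin b → Bool) where

    bipartite : Graph (a + b)
    bipartite = record
      { adj    = across false E
      ; symm   = λ u v → acrossSides-sym false E (splitAt a u) (splitAt a v)
      ; irrefl = λ u → acrossSides-diag false E (splitAt a u)
      }

    edge-join : ∀ s t → T (adj bipartite (join a b s) (join a b t)) → T (acrossSides false E s t)
    edge-join s t = subst T (across-join false E s t)

    bipartite-minDegree : ∀ {d} → (∀ x → AtLeast d (T ∘ E x)) → (∀ y → AtLeast d (λ x → T (E x y))) →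
                          MinDegreeAtLeast bipartite d
    bipartite-minDegree left right u with view u
    ... | side (inj₁ x) = let f , f-inj , f-edge = left x in
      atLeast⇒≤deg bipartite ((a ↑ʳ_) ∘ f , f-inj ∘ ↑ʳ-injective a _ _ ,
                              λ j → subst T (sym (across-join false E (inj₁ x) (inj₂ (f j)))) (f-edge j))
    ... | side (inj₂ y) = let f , f-inj , f-edge = right y in
      atLeast⇒≤deg bipartite ((_↑ˡ b) ∘ f , f-inj ∘ ↑ˡ-injective b _ _ ,
                              λ j → subst T (sym (across-join false E (inj₂ y) (inj₁ (f j)))) (f-edge j))

    module _ {k : ℕ} (c₀ : Fin k) (c : Fin a → Fin b → Fin k) where

      bipartiteColouring : EdgeColouring bipartite k
      bipartiteColouring = record
        { col      = across c₀ c
        ; col-symm = λ u v _ → acrossSides-sym c₀ c (splitAt a u) (splitAt a v)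
        }

      bipartite-proper : (∀ x {y y'} → T (E x y) → T (E x y') → c x y ≡ c x y' → y ≡ y') →
                         (∀ y {x x'} → T (E x y) → T (E x' y) → c x y ≡ c x' y → x ≡ x') →
                         Proper bipartiteColouring
      bipartite-proper left right u v w uv uw v≢w cv≡cw with view u | view v | view w
      ... | side s | side t | side t' =
        v≢w (cong (join a b) (sides s t t' (edge-join s t (≡true⇒T uv)) (edge-join s t' (≡true⇒T uw))
          (trans (sym (across-join c₀ c s t)) (trans cv≡cw (across-join c₀ c s t')))))
        where
        ≡true⇒T : ∀ {β} → β ≡ true → T β
        ≡true⇒T = Equivalence.from T-≡
        sides : ∀ s t t' → T (acrossSides false E s t) → T (acrossSides false E s t') →
                acrossSides c₀ c s t ≡ acrossSides c₀ c s t' → t ≡ t'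
        sides (inj₁ x) (inj₂ _) (inj₂ _) e e' eq = cong inj₂ (left x e e' eq)
        sides (inj₂ y) (inj₁ _) (inj₁ _) e e' eq = cong inj₁ (right y e e' eq)
        sides (inj₁ _) (inj₁ _) _        ()
        sides (inj₁ _) (inj₂ _) (inj₁ _) _ ()
        sides (inj₂ _) (inj₂ _) _        ()
        sides (inj₂ _) (inj₁ _) (inj₂ _) _ ()

      module _ (i : Fin k) where

        InClass : Fin (a + b) → Fin (a + b) → Bool
        InClass u v = adj bipartite u v ∧ (toℕ u <ᵇ toℕ v) ∧ (toℕ (col bipartiteColouring u v) ≡ᵇ toℕ i)

        inClass⇒edge : ∀ {u v} → T (InClass u v) →
                       ∃₂ λ x y → u ≡ x ↑ˡ b × v ≡ a ↑ʳ y × T (E x y) × c x y ≡ i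
        inClass⇒edge {u} {v} uv∈i with view u | view v
        ... | side s | side t with T-∧₃ (adj bipartite (join a b s) (join a b t)) (toℕ (join a b s) <ᵇ toℕ (join a b t)) uv∈i
        ... | uv-edge , u<v , uv-col = sides s t (edge-join s t uv-edge) u<v
                                         (trans (sym (across-join c₀ c s t)) (toℕ-injective (≡ᵇ⇒≡ _ _ uv-col)))
          where
          sides : ∀ s t → T (acrossSides false E s t) → T (toℕ (join a b s) <ᵇ toℕ (join a b t)) →
                  acrossSides c₀ c s t ≡ i →
                  ∃₂ λ x y → join a b s ≡ x ↑ˡ b × join a b t ≡ a ↑ʳ y × T (E x y) × c x y ≡ i
          sides (inj₁ x) (inj₂ y) e _  col = x , y , refl , refl , e , col
          sides (inj₂ y) (inj₁ x) _ lt _   = ⊥-elim (<-asym (≤-<-trans (m≤m+n a (toℕ y)) right<left) (toℕ<n x))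
            where
            right<left : a + toℕ y < toℕ x
            right<left = subst₂ _<_ (toℕ-↑ʳ a y) (toℕ-↑ˡ x b) (<ᵇ⇒< _ _ lt)
          sides (inj₁ _) (inj₁ _) ()
          sides (inj₂ _) (inj₂ _) ()

      bipartite-classSize : ∀ {L} (h : Fin a → Fin b → ℕ) → (∀ {x y} → T (E x y) → h x y < L) →
                            (∀ {x y x' y'} → T (E x y) → T (E x' y') → c x y ≡ c x' y' → h x y ≡ h x' y' →
                             x ≡ x' × y ≡ y') →
                            ∀ i → colourClassSize bipartiteColouring i ≤ L
      bipartite-classSize {L} h h<L h-inj i = begin
        colourClassSize bipartiteColouring i  ≡⟨ sum-length-filterᵇ (InClass i) (allFin _) (allFin _) ⟩
        length classList                      ≤⟨ Unique⇒length≤ classList-unique (uncurry (across 0 h)) h<L′ h-inj′ ⟩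
        L                                     ∎
        where
        open ≤-Reasoning
        classList : List (Fin (a + b) × Fin (a + b))
        classList = filterᵇ (uncurry (InClass i)) (cartesianProduct (allFin _) (allFin _))

        classList-unique : Unique classList
        classList-unique = filter⁺ (T? ∘ uncurry (InClass i)) (cartesianProduct⁺ (allFin⁺ _) (allFin⁺ _))

        inClass : ∀ {p} → p ∈ classList → T (uncurry (InClass i) p)
        inClass = proj₂ ∘ ∈-filter⁻ (T? ∘ uncurry (InClass i)) {xs = cartesianProduct (allFin _) (allFin _)}

        h-join : ∀ x y → across 0 h (x ↑ˡ b) (a ↑ʳ y) ≡ h x y
        h-join x y = across-join 0 h (inj₁ x) (inj₂ y)

        h<L′ : ∀ {p} → p ∈ classList → uncurry (across 0 h) p < L
        h<L′ p∈ with inClass⇒edge i (inClass p∈)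
        ... | x , y , refl , refl , e , _ = subst (_< L) (sym (h-join x y)) (h<L e)

        h-inj′ : ∀ {p q} → p ∈ classList → q ∈ classList → uncurry (across 0 h) p ≡ uncurry (across 0 h) q → p ≡ q
        h-inj′ p∈ q∈ eq with inClass⇒edge i (inClass p∈) | inClass⇒edge i (inClass q∈)
        ... | x , y , refl , refl , e , cxy | x' , y' , refl , refl , e' , cxy'
          with h-inj e e' (trans cxy (sym cxy')) (trans (sym (h-join x y)) (trans eq (h-join x' y')))
        ... | refl , refl = refl

ColouredGraph : ℕ → ℕ → ℕ → ℕ → Set
ColouredGraph n d k ℓ = Σ (Graph n) λ G → MinDegreeAtLeast G d ×
  Σ (EdgeColouring G k) λ c → Proper c × (∀ i → colourClassSize c i ≤ ℓ)

module Circulant {m' m d L k : ℕ} .{{_ : NonZero m}} .{{_ : NonZero L}} .{{_ : NonZero k}}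
                 (m≤m' : m ≤ m') (m'≤1+m : m' ≤ suc m) (d≤m : d ≤ m) (L≤m : L ≤ m)
                 (fits : d * suc m ≤ k * L) where

  open Modular m
  open Bipartite {m'} {m}

  shift : Fin m' → Fin m → ℕ
  shift x y = toℕ y ⊖ toℕ x

  number : Fin m' → Fin m → ℕ
  number x y = shift x y * suc m + toℕ x

  IsEdge : Fin m' → Fin m → Bool
  IsEdge x y = shift x y <ᵇ d

  colour : Fin m' → Fin m → Fin k
  colour x y = (number x y / L) mod k

  number%[1+m] : ∀ x y → number x y % suc m ≡ toℕ x
  number%[1+m] x y = begin
    (shift x y * suc m + toℕ x) % suc m  ≡⟨ cong (_% suc m) (+-comm (shift x y * suc m) (toℕ x)) ⟩
    (toℕ x + shift x y * suc m) % suc m  ≡⟨ [m+kn]%n≡m%n (toℕ x) (shift x y) (suc m) ⟩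
    toℕ x % suc m                        ≡⟨ m<n⇒m%n≡m (≤-trans (toℕ<n x) m'≤1+m) ⟩
    toℕ x                                ∎
    where open ≡-Reasoning

  number%m : ∀ x y → number x y % m ≡ toℕ y
  number%m x y = begin
    (shift x y * suc m + toℕ x) % m          ≡⟨ cong (_% m) (rearrange (shift x y) (toℕ x) m) ⟩
    (toℕ x + shift x y + shift x y * m) % m  ≡⟨ [m+kn]%n≡m%n (toℕ x + shift x y) (shift x y) m ⟩
    (toℕ x + shift x y) % m                  ≡⟨ [x+[y⊖x]]%m≡y%m (toℕ x) (toℕ y) ⟩
    toℕ y % m                                ≡⟨ m<n⇒m%n≡m (toℕ<n y) ⟩
    toℕ y                                    ∎
    where
    open ≡-Reasoning
    rearrange : ∀ r x m → r * suc m + x ≡ x + r + r * m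
    rearrange = solve-∀

  number-injective : ∀ {x y x' y'} → number x y ≡ number x' y' → x ≡ x' × y ≡ y'
  number-injective {x} {y} {x'} {y'} eq =
    toℕ-injective (trans (sym (number%[1+m] x y)) (trans (cong (_% suc m) eq) (number%[1+m] x' y'))) ,
    toℕ-injective (trans (sym (number%m x y)) (trans (cong (_% m) eq) (number%m x' y')))

  number<d*[1+m] : ∀ {x y} → T (IsEdge x y) → number x y < d * suc m
  number<d*[1+m] {x} {y} e = begin-strict
    shift x y * suc m + toℕ x  <⟨ +-monoʳ-< (shift x y * suc m) (≤-trans (toℕ<n x) m'≤1+m) ⟩
    shift x y * suc m + suc m  ≡⟨ +-comm (shift x y * suc m) (suc m) ⟩
    suc (shift x y) * suc m    ≤⟨ *-monoˡ-≤ (suc m) (<ᵇ⇒< (shift x y) d e) ⟩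
    d * suc m                  ∎
    where open ≤-Reasoning

  toℕ-colour : ∀ {x y} → T (IsEdge x y) → toℕ (colour x y) ≡ number x y / L
  toℕ-colour e = trans (toℕ-fromℕ< _) (m<n⇒m%n≡m (m<n*o⇒m/o<n (<-≤-trans (number<d*[1+m] e) fits)))

  sameColour⇒sameBlock : ∀ {x y x' y'} → T (IsEdge x y) → T (IsEdge x' y') →
                         colour x y ≡ colour x' y' → number x y / L ≡ number x' y' / L
  sameColour⇒sameBlock e e' eq = trans (sym (toℕ-colour e)) (trans (cong toℕ eq) (toℕ-colour e'))

  forward : Fin m' → Fin d → Fin m
  forward x r = (toℕ x + toℕ r) mod m

  shift-forward : ∀ x (r : Fin d) → shift x (forward x r) ≡ toℕ r
  shift-forward x r = begin
    toℕ ((toℕ x + toℕ r) mod m) ⊖ toℕ x  ≡⟨ cong (_⊖ toℕ x) (toℕ-fromℕ< _) ⟩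
    ((toℕ x + toℕ r) % m) ⊖ toℕ x        ≡⟨ [x+r]%m⊖x≡r%m (toℕ x) (toℕ r) ⟩
    toℕ r % m                            ≡⟨ m<n⇒m%n≡m (<-≤-trans (toℕ<n r) d≤m) ⟩
    toℕ r                                ∎
    where open ≡-Reasoning

  backward : Fin m → Fin d → Fin m'
  backward y r = fromℕ< (<-≤-trans (⊖<m (toℕ y) (toℕ r)) m≤m')

  shift-backward : ∀ y (r : Fin d) → shift (backward y r) y ≡ toℕ r
  shift-backward y r = begin
    toℕ y ⊖ toℕ (backward y r)  ≡⟨ cong (toℕ y ⊖_) (toℕ-fromℕ< _) ⟩
    toℕ y ⊖ (toℕ y ⊖ toℕ r)     ≡⟨ y⊖[y⊖r]≡r%m (toℕ y) (toℕ r) ⟩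
    toℕ r % m                   ≡⟨ m<n⇒m%n≡m (<-≤-trans (toℕ<n r) d≤m) ⟩
    toℕ r                       ∎
    where open ≡-Reasoning

  shift≡⇒edge : ∀ {x y} (r : Fin d) → shift x y ≡ toℕ r → T (IsEdge x y)
  shift≡⇒edge r eq = subst (λ i → T (i <ᵇ d)) (sym eq) (<⇒<ᵇ (toℕ<n r))

  forwardNeighbours : ∀ x → AtLeast d (T ∘ IsEdge x)
  forwardNeighbours x = forward x , forward-injective , λ r → shift≡⇒edge r (shift-forward x r)
    where
    forward-injective : ∀ {r r'} → forward x r ≡ forward x r' → r ≡ r'
    forward-injective {r} {r'} eq =
      toℕ-injective (trans (sym (shift-forward x r)) (trans (cong (shift x) eq) (shift-forward x r')))

  backwardNeighbours : ∀ y → AtLeast d (λ x → T (IsEdge x y))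
  backwardNeighbours y = backward y , backward-injective , λ r → shift≡⇒edge r (shift-backward y r)
    where
    backward-injective : ∀ {r r'} → backward y r ≡ backward y r' → r ≡ r'
    backward-injective {r} {r'} eq =
      toℕ-injective (trans (sym (shift-backward y r)) (trans (cong (λ x → shift x y) eq) (shift-backward y r')))

  circulant : ColouredGraph (m' + m) d k L
  circulant =
    bipartite IsEdge ,
    bipartite-minDegree IsEdge forwardNeighbours backwardNeighbours ,
    bipartiteColouring IsEdge (0 mod k) colour ,
    bipartite-proper IsEdge (0 mod k) colour properAtLeft properAtRight ,
    bipartite-classSize IsEdge (0 mod k) colour (λ x y → number x y % L) (λ _ → m%n<n _ L) sameClass⇒equal
    where
    properAtLeft : ∀ x {y y'} → T (IsEdge x y) → T (IsEdge x y') → colour x y ≡ colour x y' → y ≡ y'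
    properAtLeft x {y} {y'} e e' eq = proj₂ (number-injective (/-%-injective (m≤n⇒m≤1+n L≤m)
      (sameColour⇒sameBlock e e' eq) (trans (number%[1+m] x y) (sym (number%[1+m] x y')))))
    properAtRight : ∀ y {x x'} → T (IsEdge x y) → T (IsEdge x' y) → colour x y ≡ colour x' y → x ≡ x'
    properAtRight y {x} {x'} e e' eq = proj₁ (number-injective (/-%-injective L≤m
      (sameColour⇒sameBlock e e' eq) (trans (number%m x y) (sym (number%m x' y)))))
    sameClass⇒equal : ∀ {x y x' y'} → T (IsEdge x y) → T (IsEdge x' y') → colour x y ≡ colour x' y' →
                      number x y % L ≡ number x' y' % L → x ≡ x' × y ≡ y'
    sameClass⇒equal e e' eq %-eq = number-injective (/-%-injective ≤-refl (sameColour⇒sameBlock e e' eq) %-eq)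

edgeless : ∀ {n k ℓ} .{{_ : NonZero k}} → ColouredGraph n 0 k ℓ
edgeless {n} {k} =
  bipartite noEdge ,
  (λ _ → z≤n) ,
  bipartiteColouring noEdge (0 mod k) (λ ()) ,
  bipartite-proper noEdge (0 mod k) (λ ()) (λ ()) (λ { _ {()} }) ,
  bipartite-classSize noEdge (0 mod k) (λ ()) (λ ()) (λ { {()} }) (λ { {()} })
  where
  open Bipartite {0} {n}
  noEdge : Fin 0 → Fin n → Bool
  noEdge ()

nonZero-factors : ∀ {k ℓ} → 0 < k * ℓ → NonZero k × NonZero ℓ
nonZero-factors {k} 0<kℓ = m*n≢0⇒m≢0 k {{>-nonZero 0<kℓ}} , m*n≢0⇒n≢0 k {{>-nonZero 0<kℓ}}

2*m≤n⇒m≤⌊n/2⌋ : ∀ {m n} → 2 * m ≤ n → m ≤ ⌊ n /2⌋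
2*m≤n⇒m≤⌊n/2⌋ {m} {n} 2m≤n =
  subst (_≤ ⌊ n /2⌋) (sym (n≡⌊n+n/2⌋ m)) (⌊n/2⌋-mono (subst (_≤ n) (cong (_+_ m) (+-identityʳ m)) 2m≤n))

2*d≤32*[d*d] : ∀ d → 2 * d ≤ 32 * (d * d)
2*d≤32*[d*d] zero        = z≤n
2*d≤32*[d*d] d@(suc _) = *-mono-≤ (m≤m+n 2 30) (m≤m*n d d)

d*[1+⌊n/2⌋]<k*ℓ : ∀ n d k ℓ → n * d + 32 * (d * d) < 2 * k * ℓ → d * suc ⌊ n /2⌋ < k * ℓ
d*[1+⌊n/2⌋]<k*ℓ n d k ℓ edges = *-cancelˡ-< 2 (d * suc m) (k * ℓ) (begin-strict
  2 * (d * suc m)       ≡⟨ expand d m ⟩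
  (m + m) * d + 2 * d   ≤⟨ +-mono-≤ (*-monoˡ-≤ d m+m≤n) (2*d≤32*[d*d] d) ⟩
  n * d + 32 * (d * d)  <⟨ edges ⟩
  2 * k * ℓ             ≡⟨ *-assoc 2 k ℓ ⟩
  2 * (k * ℓ)           ∎)
  where
  open ≤-Reasoning
  m = ⌊ n /2⌋
  m+m≤n : m + m ≤ n
  m+m≤n = subst (_≤_ (m + m)) (⌊n/2⌋+⌈n/2⌉≡n n) (+-monoʳ-≤ m (⌊n/2⌋≤⌈n/2⌉ n))
  expand : ∀ d m → 2 * (d * suc m) ≡ (m + m) * d + 2 * d
  expand = solve-∀

halvedCirculant : ∀ {n d k ℓ} .{{_ : NonZero d}} .{{_ : NonZero k}} .{{_ : NonZero ℓ}} →
                  2 * ℓ ≤ n → 32 * d ≤ n → d * suc ⌊ n /2⌋ ≤ k * ℓ → ColouredGraph n d k ℓ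
halvedCirculant {n} {d} {k} {ℓ} 2ℓ≤n 32d≤n fits =
  subst (λ N → ColouredGraph N d k ℓ) (trans (+-comm ⌈ n /2⌉ ⌊ n /2⌋) (⌊n/2⌋+⌈n/2⌉≡n n))
    (Circulant.circulant {{⌊n/2⌋≢0}} (⌊n/2⌋≤⌈n/2⌉ n) (⌊n/2⌋-mono (n≤1+n (suc n)))
      (2*m≤n⇒m≤⌊n/2⌋ 2d≤n) (2*m≤n⇒m≤⌊n/2⌋ 2ℓ≤n) fits)
  where
  2d≤n : 2 * d ≤ n
  2d≤n = ≤-trans (*-monoˡ-≤ d (m≤m+n 2 30)) 32d≤n
  ⌊n/2⌋≢0 : NonZero ⌊ n /2⌋
  ⌊n/2⌋≢0 = >-nonZero (⌊n/2⌋-mono (≤-trans (m≤m*n 2 d) 2d≤n))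

colouredGraph : ∀ {n d k ℓ} → 2 * ℓ ≤ n → 32 * d ≤ n → d * suc ⌊ n /2⌋ < k * ℓ → ColouredGraph n d k ℓ
colouredGraph {d = zero}  _     _     fits = edgeless {{proj₁ (nonZero-factors (≤-<-trans z≤n fits))}}
colouredGraph {d = suc _} 2ℓ≤n 32d≤n fits =
  halvedCirculant {{_}} {{proj₁ k,ℓ≢0}} {{proj₂ k,ℓ≢0}} 2ℓ≤n 32d≤n (<⇒≤ fits)
  where k,ℓ≢0 = nonZero-factors (≤-<-trans z≤n fits)

0<a/n-d-c/n⇒n*d+c<a : ∀ a c d n .{{_ : NonZero n}} → 0ℚ <ℚ (+ a /ℚ n) -ℚ fromℕ d -ℚ (+ c /ℚ n) → n * d + c < a
0<a/n-d-c/n⇒n*d+c<a a c d n@(suc n-1) 0<X = ℤ.drop‿+<+ (subst (ℤ._< + a) (sym s≡) (ℤ.*-cancelˡ-<-nonNeg N N*s<N*a))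
  where
  N : ℤ
  N = + n
  Y : ℚᵘ
  Y = mkℚᵘ (+ a) n-1 ℚᵘ.- mkℚᵘ (+ d) 0 ℚᵘ.- mkℚᵘ (+ c) n-1

  toℚᵘ[i/n] : ∀ i → toℚᵘ (i /ℚ n) ≃ mkℚᵘ i n-1
  toℚᵘ[i/n] i = ℚ.toℚᵘ-fromℚᵘ (mkℚᵘ i n-1)

  toℚᵘ-homo-minus : ∀ p q → toℚᵘ (p -ℚ q) ≃ toℚᵘ p ℚᵘ.- toℚᵘ q
  toℚᵘ-homo-minus p q = ℚᵘ.≃-trans (ℚ.toℚᵘ-homo-+ p (ℚ.- q)) (ℚᵘ.+-congʳ (toℚᵘ p) (ℚ.toℚᵘ-homo‿- q))

  X≃Y : toℚᵘ ((+ a /ℚ n) -ℚ fromℕ d -ℚ (+ c /ℚ n)) ≃ Y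
  X≃Y = ℚᵘ.≃-trans (toℚᵘ-homo-minus (+ a /ℚ n -ℚ fromℕ d) (+ c /ℚ n)) (ℚᵘ.+-cong
          (ℚᵘ.≃-trans (toℚᵘ-homo-minus (+ a /ℚ n) (fromℕ d)) (ℚᵘ.+-cong (toℚᵘ[i/n] (+ a)) (ℚᵘ.-‿cong (ℚ.toℚᵘ-fromℚᵘ (mkℚᵘ (+ d) 0)))))
          (ℚᵘ.-‿cong (toℚᵘ[i/n] (+ c))))

  -- ℚᵘ does not normalise, so 0 < Y unfolds to an inequality between explicit integers.
  0<↥Y*1 : + 0 ℤ.< ↥ Y ℤ.* + 1
  0<↥Y*1 with ℚᵘ.<-respʳ-≃ X≃Y (ℚ.toℚᵘ-mono-< 0<X)
  ... | *<* 0<↥Y*1 = 0<↥Y*1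

  s : ℤ
  s = + d ℤ.* N ℤ.+ + c

  s≡ : + (n * d + c) ≡ s
  s≡ = trans (ℤ.pos-+ (n * d) c) (cong (ℤ._+ + c) (trans (ℤ.pos-* n d) (ℤ.*-comm N (+ d))))

  ↥Y≡ : ↥ Y ≡ ((+ a) ℤ.* + 1 ℤ.+ ℤ.- + d ℤ.* N) ℤ.* N ℤ.+ ℤ.- + c ℤ.* N
  ↥Y≡ = cong (λ i → ((+ a) ℤ.* + 1 ℤ.+ ℤ.- + d ℤ.* N) ℤ.* N ℤ.+ ℤ.- + c ℤ.* + i) (*-identityʳ n)

  N*s<N*a : N ℤ.* s ℤ.< N ℤ.* + a
  N*s<N*a = subst₂ ℤ._<_ (ℤ.+-identityˡ (N ℤ.* s)) (trans (cong (λ i → i ℤ.* + 1 ℤ.+ N ℤ.* s) ↥Y≡) (identity (+ a) (+ c) (+ d) N))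
              (ℤ.+-monoˡ-< (N ℤ.* s) 0<↥Y*1)
    where
    identity : ∀ a c d N → ((a ℤ.* + 1 ℤ.+ ℤ.- d ℤ.* N) ℤ.* N ℤ.+ ℤ.- c ℤ.* N) ℤ.* + 1 ℤ.+ N ℤ.* (d ℤ.* N ℤ.+ c) ≡ N ℤ.* a
    identity = ℤ-Solver.solve-∀

lemma5p2 : (n d k ℓ : ℕ) → .{{_ : NonZero n}} →
    2 * ℓ ≤ n →
    (2 ^ 5) * d ≤ n →
    let X = ((+ (2 * k * ℓ)) /ℚ n) -ℚ fromℕ d -ℚ ((+ ((2 ^ 5) * (d * d))) /ℚ n) in
    0ℚ <ℚ X →
    (∃ λ (q : ℚ) → ∃ λ (N : ℕ) →
    (fromℕ (16 * d) *ℚ (q *ℚ q) <ℚ X *ℚ X) × (fromℕ n <ℚ expPartial q N)) →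
    Σ (Graph n) λ G → MinDegreeAtLeast G d ×
    Σ (EdgeColouring G k) λ c → Proper c × (∀ i → colourClassSize c i ≤ ℓ)
lemma5p2 n d k ℓ 2ℓ≤n 32d≤n 0<X _ =
  colouredGraph 2ℓ≤n 32d≤n (d*[1+⌊n/2⌋]<k*ℓ n d k ℓ (0<a/n-d-c/n⇒n*d+c<a (2 * k * ℓ) (2 ^ 5 * (d * d)) d n 0<X))
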